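{- Let $G$ be a plane bipartite graph with a perfect matching. Then the resonance graph $R(G)$ is (isomorphic to) a daisy cube with $\mathrm{idim}(R(G))=0$ if and only if $G$ is a plane weakly elementary bipartite graph such that each elementary component of $G$ is $K_2$.
   Context: For a graph with a perfect matching, an edge is allowed if it lies in some perfect matching and forbidden otherwise. For a plane bipartite graph $G$ with a perfect matching, the elementary components of $G$ are the connected components of the graph obtained from $G$ by deleting all forbidden edges. A plane bipartite graph (not necessarily connected) is weakly elementary if deleting all its forbidden edges does not produce any new finite face. The resonance graph $R(G)$ of a plane bipartite graph $G$ has the perfect matchings of $G$ as vertices, two perfect matchings $M_1,M_2$ being adjacent iff their symmetric difference $M_1\oplus M_2$ is exactly one cycle which is the boundary (periphery) of some finite face of $G$. Let $\mathcal{B}^n=\{0,1\}^n$ with the componentwise partial order $u\le v$ iff $u_i\le v_i$ for all $i$; the hypercube $Q_n$ has vertex set $\mathcal{B}^n$, two strings adjacent iff they differ in exactly one position ($Q_0=K_1$). A daisy cube is a graph isomorphic to $Q_n(X)=\langle\{u\in\mathcal{B}^n : u\le x \text{ for some } x\in X\}\rangle$ (induced subgraph of $Q_n$) for some nonempty $X\subseteq\mathcal{B}^n$, or to $K_1=Q_0$. Daisy cubes are isometric subgraphs of hypercubes; the isometric dimension $\mathrm{idim}(H)$ of such a graph $H$ is the least $n$ such that $H$ embeds isometrically into $Q_n$. -}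

module Defs where

open import Data.Nat using (ℕ; zero; suc; _+_; _*_; _≤_; _<_; _≡ᵇ_)
open import Data.Fin using (Fin; zero; suc; _≟_)
open import Data.Fin.Base using () renaming (zero to fzero)
open import Data.Bool using (Bool; true; false; not; _∧_; _∨_; _xor_; T; if_then_else_)
open import Data.Product using (Σ; ∃; ∃-syntax; _×_; _,_; proj₁; proj₂)
open import Data.Sum using (_⊎_)
open import Data.Empty using (⊥)
open import Data.Unit using (⊤)
open import Data.Vec using (Vec; []; _∷_; lookup; tabulate; zipWith)
open import Data.List using (List; []; _∷_; allFin; filter; length)
open import Data.Bool.ListAction using (any; all)
open import Relation.Nullary using (¬_)
open import Relation.Nullary.Decidable using (⌊_⌋)
open import Relation.Binary.PropositionalEquality using (_≡_; _≢_)
open import Function.Bundles using (_↔_; _⇔_; Inverse)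

iter : {A : Set} → (A → A) → ℕ → A → A
iter f zero    x = x
iter f (suc j) x = f (iter f j x)

countFin : (m : ℕ) → (Fin m → Bool) → ℕ
countFin m p = length (filter (λ i → T? (p i)) (allFin m))
  where
  open import Data.Bool.Properties using (T?)

hamming : {n : ℕ} → Vec Bool n → Vec Bool n → ℕ
hamming []       []       = 0
hamming (x ∷ xs) (y ∷ ys) = (if x xor y then 1 else 0) + hamming xs ys

_≤ᵥ_ : {n : ℕ} → Vec Bool n → Vec Bool n → Bool
[]       ≤ᵥ []       = true
(x ∷ xs) ≤ᵥ (y ∷ ys) = (not x ∨ y) ∧ (xs ≤ᵥ ys)

record Graph : Set₁ where
  field
    V   : Set
    Adj : V → V → Set

open Graph public

record _≅_ (G H : Graph) : Set where
  field
    bij     : V G ↔ V H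
  open Inverse bij public using (to)
  field
    adj-iff : ∀ u v → Adj G u v ⇔ Adj H (to u) (to v)

data Walk (G : Graph) : V G → V G → ℕ → Set where
  here : ∀ {u} → Walk G u u 0
  step : ∀ {u v w k} → Adj G u v → Walk G v w k → Walk G u w (suc k)

Dist : (G : Graph) → V G → V G → ℕ → Set
Dist G u v k = Walk G u v k × (∀ j → Walk G u v j → k ≤ j)

IsometricEmbedding : Graph → ℕ → Set
IsometricEmbedding G n =
  Σ (V G → Vec Bool n) λ f → ∀ u v → Dist G u v (hamming (f u) (f v))

Idim : Graph → ℕ → Set
Idim G d = IsometricEmbedding G d × (∀ d' → IsometricEmbedding G d' → d ≤ d')

Qdaisy : (n : ℕ) → List (Vec Bool n) → Graph
Qdaisy n X = record
  { V   = Σ (Vec Bool n) (λ u → T (any (λ x → u ≤ᵥ x) X))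
  ; Adj = λ u v → hamming (proj₁ u) (proj₁ v) ≡ 1
  }

K1 : Graph
K1 = record { V = ⊤ ; Adj = λ _ _ → ⊥ }

IsDaisyCube : Graph → Set
IsDaisyCube H =
  (Σ ℕ λ n → Σ (List (Vec Bool n)) λ X → (X ≢ []) × (H ≅ Qdaisy n X))
  ⊎ (H ≅ K1)

-- The embedding is given by a
-- rotation system σ (cyclic order of darts around each vertex) of genus 0
-- on every component, together with the nesting data describing how the
-- components sit in the plane: each boundary walk (φ-orbit, φ = σ ∘ α)
-- is labelled with the face of G it bounds (face 0 = the infinite face,
-- faces 1..k = the finite faces); every nontrivial component has exactly
-- one "outer" walk; every finite face has exactly one "inner" walk (its
-- outer boundary) and the infinite face none; the nesting is acyclic.

Dart : ℕ → Set
Dart m = Fin m × Bool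

α : {m : ℕ} → Dart m → Dart m
α (e , b) = (e , not b)

data Reach {n m : ℕ} (ends : Fin m → Fin n × Fin n) (E : Fin m → Set)
           : Fin n → Fin n → Set where
  refl′ : ∀ {u} → Reach ends E u u
  fwd   : ∀ {u w} (e : Fin m) → E e → proj₁ (ends e) ≡ u →
          Reach ends E (proj₂ (ends e)) w → Reach ends E u w
  bwd   : ∀ {u w} (e : Fin m) → E e → proj₂ (ends e) ≡ u →
          Reach ends E (proj₁ (ends e)) w → Reach ends E u w

Inc : {n m : ℕ} → (Fin m → Fin n × Fin n) → Fin n → Fin m → Set
Inc ends v e = (proj₁ (ends e) ≡ v) ⊎ (proj₂ (ends e) ≡ v)

dartTail : {n m : ℕ} → (Fin m → Fin n × Fin n) → Dart m → Fin n
dartTail ends (e , false) = proj₁ (ends e)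
dartTail ends (e , true)  = proj₂ (ends e)

record PlaneGraph : Set₁ where
  field
    n m k : ℕ
    ends  : Fin m → Fin n × Fin n

  tail : Dart m → Fin n
  tail = dartTail ends

  Conn : Fin n → Fin n → Set
  Conn = Reach ends (λ _ → ⊤)

  Isolated : Fin n → Set
  Isolated v = ∀ e → ¬ Inc ends v e

  field
    σ σ⁻¹    : Dart m → Dart m
    σ-inv₁   : ∀ d → σ (σ⁻¹ d) ≡ d
    σ-inv₂   : ∀ d → σ⁻¹ (σ d) ≡ d
    σ-vertex : ∀ d → tail (σ d) ≡ tail d
    σ-cyclic : ∀ d d' → tail d ≡ tail d' → ∃[ j ] iter σ j d ≡ d'

  φ : Dart m → Dart m
  φ d = σ (α d)

  Orbit : Dart m → Dart m → Set
  Orbit d d' = ∃[ j ] iter φ j d ≡ d'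

  field
    c F I   : ℕ
    comp    : Fin n → Fin c
    comp-ok : ∀ u v → (comp u ≡ comp v) ⇔ Conn u v
    comp-on : ∀ i → ∃[ u ] comp u ≡ i
    orb     : Dart m → Fin F
    orb-ok  : ∀ d d' → (orb d ≡ orb d') ⇔ Orbit d d'
    orb-on  : ∀ i → ∃[ d ] orb d ≡ i
    isol    : Fin I → Fin n
    isol-inj : ∀ i j → isol i ≡ isol j → i ≡ j
    isol-ok : ∀ v → Isolated v ⇔ (∃[ i ] isol i ≡ v)
    -- genus 0 on every component (Euler: sum of (V - E + F) over the
    -- nontrivial components equals 2·(their number))
    euler   : n + F + I ≡ 2 * c + m
    outer      : Dart m → Bool
    outer-orb  : ∀ d d' → Orbit d d' → outer d ≡ outer d'
    outer-ex   : ∀ d → ∃[ d' ] (outer d' ≡ true × Conn (tail d) (tail d'))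
    outer-uniq : ∀ d d' → outer d ≡ true → outer d' ≡ true →
                 Conn (tail d) (tail d') → Orbit d d'
    face       : Dart m → Fin (suc k)
    face-orb   : ∀ d d' → Orbit d d' → face d ≡ face d'
    inner-fin  : ∀ d → outer d ≡ false → face d ≢ zero
    inner-ex   : ∀ (f : Fin k) → ∃[ d ] (outer d ≡ false × face d ≡ suc f)
    inner-uniq : ∀ d d' → outer d ≡ false → outer d' ≡ false →
                 face d ≡ face d' → Orbit d d'
    depth      : Fin n → ℕ
    depth-conn : ∀ u v → Conn u v → depth u ≡ depth v
    depth-nest : ∀ d d' → outer d ≡ true → outer d' ≡ false →
                 face d ≡ face d' → depth (tail d') < depth (tail d)

module PG (G : PlaneGraph) where
  open PlaneGraph G public

  side : Fin m → Bool → Fin (suc k)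
  side e b = face (e , b)

  boundary : Fin (suc k) → Vec Bool m
  boundary f = tabulate (λ e → ⌊ side e false ≟ f ⌋ ∨ ⌊ side e true ≟ f ⌋)

  deg : Vec Bool m → Fin n → ℕ
  deg S v = countFin m (λ e → lookup S e ∧ (⌊ proj₁ (ends e) ≟ v ⌋ ∨ ⌊ proj₂ (ends e) ≟ v ⌋))

  IsCycle : Vec Bool m → Set
  IsCycle S =
    (∃[ e ] lookup S e ≡ true)
    × (∀ v → (deg S v ≡ 0) ⊎ (deg S v ≡ 2))
    × (∀ e e' → lookup S e ≡ true → lookup S e' ≡ true →
         Reach ends (λ x → lookup S x ≡ true) (proj₁ (ends e)) (proj₁ (ends e')))

  isPM : Vec Bool m → Bool
  isPM M = all (λ v → deg M v ≡ᵇ 1) (allFin n)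

  PerfectMatching : Set
  PerfectMatching = Σ (Vec Bool m) (λ M → T (isPM M))

  R : Graph
  R = record
    { V   = PerfectMatching
    ; Adj = λ M₁ M₂ → ∃[ f ] (f ≢ zero
              × zipWith _xor_ (proj₁ M₁) (proj₁ M₂) ≡ boundary f
              × IsCycle (boundary f))
    }

  Allowed : Fin m → Set
  Allowed e = Σ PerfectMatching λ M → lookup (proj₁ M) e ≡ true

  Forbidden : Fin m → Set
  Forbidden e = ¬ Allowed e

  -- faces of G merged by deleting forbidden edges (deleting an edge merges
  -- the two faces on its sides)
  data Merge : Fin (suc k) → Fin (suc k) → Set where
    mrefl : ∀ {f} → Merge f f
    mstep : ∀ {f} e b → Merge f (side e b) → Forbidden e → Merge f (side e (not b))

  -- a new finite face of G − F: a class of merged faces not containing the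
  -- infinite face whose region contains (the interior of) a deleted edge
  NewFiniteFace : Set
  NewFiniteFace = ∃[ f ] (¬ Merge f zero × ∃[ e ] ∃[ b ] (Forbidden e × Merge f (side e b)))

  WeaklyElementary : Set
  WeaklyElementary = ¬ NewFiniteFace

  -- elementary components: components of G − F
  ElemReach : Fin n → Fin n → Set
  ElemReach = Reach ends Allowed

  EachElemCompK2 : Set
  EachElemCompK2 = ∀ v → ∃[ w ] (v ≢ w
      × (∀ u → ElemReach v u → (u ≡ v) ⊎ (u ≡ w))
      × ∃[ e ] (Allowed e × Inc ends v e × Inc ends w e
                × (∀ e' → Allowed e' → Inc ends v e' ⊎ Inc ends w e' → e' ≡ e)))

  Bipartite : Set
  Bipartite = Σ (Fin n → Bool) λ col →
    ∀ (e : Fin m) → col (proj₁ (ends e)) ≢ col (proj₂ (ends e))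

-- If R(G) embeds isometrically into Q₀ then G has exactly one perfect matching M₀, so the
-- forbidden edges are exactly those outside M₀. Around every vertex all edges but its matching
-- edge are then forbidden, so all faces at a vertex merge, hence all faces along a component
-- merge; walking outwards through the nesting of components (by depth) reaches the infinite
-- face, so no finite face is created, and the elementary components are the edges of M₀.
-- Conversely, if every elementary component is K₂ then each allowed edge is the unique allowed
-- edge at its ends and so lies in every perfect matching: the perfect matching is unique and
-- R(G) = K₁.
module Submission where

open import Defs
open import Data.Product using (_×_)
open import Function.Bundles using (_⇔_)

open import Data.Bool using (Bool; true; false; not; _∧_; _∨_; _xor_; T)
open import Data.Bool.Properties using (T?; T-≡; T-∧; T-∨; T-irrelevant; ⇔→≡; xor-same; not-involutive)
open import Data.Empty using (⊥-elim)
open import Data.Fin using (Fin; zero; suc; _≟_)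
open import Data.List using (List; []; _∷_; allFin; filter; length)
open import Data.List.Membership.Propositional using (_∈_)
open import Data.List.Membership.Propositional.Properties using (∈-filter⁺; ∈-filter⁻; ∈-allFin)
open import Data.List.Relation.Unary.Any using (here; there)
import Data.List.Relation.Unary.All as All
open import Data.List.Relation.Unary.All.Properties using (all⁺)
open import Data.Nat using (ℕ; zero; suc; _≤_; _<_; z≤n; s≤s)
open import Data.Nat.Induction using (<-wellFounded)
open import Data.Nat.Properties using (≡ᵇ⇒≡; <-irrefl)
open import Data.Product using (∃-syntax; _,_; proj₁; proj₂)
open import Data.Product.Properties using (Σ-≡,≡→≡)
open import Data.Sum using (_⊎_; inj₁; inj₂)
import Data.Sum as Sum
open import Data.Unit using (⊤; tt)
open import Data.Vec using ([]; lookup)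
open import Data.Vec.Properties using (lookup-zipWith; tabulate∘lookup; tabulate-cong)
open import Function using (_∘_; id)
open import Function.Bundles using (Equivalence; mk⇔; mk↔ₛ′)
open import Induction.WellFounded using (Acc; acc)
open import Relation.Nullary using (¬_; yes; no)
open import Relation.Nullary.Decidable using (⌊_⌋; toWitness; fromWitness)
open import Relation.Binary.PropositionalEquality using (_≡_; _≢_; refl; sym; trans; cong; subst)

distinct-∈⇒2≤length : ∀ {A : Set} {x y : A} {xs : List A} → x ∈ xs → y ∈ xs → x ≢ y → 2 ≤ length xs
distinct-∈⇒2≤length (here refl) (here refl) x≢y = ⊥-elim (x≢y refl)
distinct-∈⇒2≤length {xs = _ ∷ _ ∷ _} _ _ _ = s≤s (s≤s z≤n)
distinct-∈⇒2≤length {xs = _ ∷ []} (here _) (there ())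
distinct-∈⇒2≤length {xs = _ ∷ []} (there ()) _

module _ {m : ℕ} (p : Fin m → Bool) where

  countFin≡1⇒witness : countFin m p ≡ 1 → ∃[ i ] T (p i)
  countFin≡1⇒witness c≡1 with filter (λ i → T? (p i)) (allFin m) in selected
  countFin≡1⇒witness () | []
  countFin≡1⇒witness _ | i ∷ _ =
    i , proj₂ (∈-filter⁻ (λ i → T? (p i)) {xs = allFin m} (subst (i ∈_) (sym selected) (here refl)))

  countFin≡1⇒unique : countFin m p ≡ 1 → ∀ {i j} → T (p i) → T (p j) → i ≡ j
  countFin≡1⇒unique c≡1 {i} {j} pi pj with i ≟ j
  ... | yes i≡j = i≡j
  ... | no i≢j  = ⊥-elim (<-irrefl refl (subst (2 ≤_) c≡1
        (distinct-∈⇒2≤length (select i pi) (select j pj) i≢j)))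
    where
    select : ∀ k → T (p k) → k ∈ filter (λ i → T? (p i)) (allFin m)
    select k pk = ∈-filter⁺ (λ i → T? (p i)) (∈-allFin k) pk

module _ {G : Graph} where

  Walk-length-zero : ∀ {u v} → Walk G u v 0 → u ≡ v
  Walk-length-zero here = refl

  isometric-Q₀⇒trivial : IsometricEmbedding G 0 → ∀ u v → u ≡ v
  isometric-Q₀⇒trivial (f , isometric) u v with f u | f v | isometric u v
  ... | [] | [] | walk , _ = Walk-length-zero walk

  trivial⇒Idim0 : (∀ u v → u ≡ v) → Idim G 0
  trivial⇒Idim0 trivial = ((λ _ → []) , distance-zero) , λ _ _ → z≤n
    where
    distance-zero : ∀ u v → Dist G u v 0
    distance-zero u v with trivial u v
    ... | refl = here , λ _ _ → z≤n

  trivial⇒≅K1 : (∀ u v → u ≡ v) → V G → (∀ u → ¬ Adj G u u) → G ≅ K1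
  trivial⇒≅K1 trivial u₀ irreflexive = record
    { bij     = mk↔ₛ′ (λ _ → tt) (λ _ → u₀) (λ _ → refl) (trivial u₀)
    ; adj-iff = λ u v → mk⇔ (irreflexive u ∘ subst (Adj G u) (trivial v u)) λ ()
    }

Reach-transport : ∀ {n m} {ends : Fin m → Fin n × Fin n} {E : Fin m → Set} (P : Fin n → Set) →
  (∀ e → E e → ∀ b → P (dartTail ends (e , b)) → P (dartTail ends (e , not b))) →
  ∀ {u w} → Reach ends E u w → P u → P w
Reach-transport P cross refl′                 Pu = Pu
Reach-transport P cross (fwd e Ee refl reach) Pu = Reach-transport P cross reach (cross e Ee false Pu)
Reach-transport P cross (bwd e Ee refl reach) Pu = Reach-transport P cross reach (cross e Ee true Pu)

α-involutive : ∀ {m} (d : Dart m) → α (α d) ≡ d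
α-involutive (e , b) = cong (e ,_) (not-involutive b)

module PlaneGraphProperties (G : PlaneGraph) where
  open PG G

  Loopless : Set
  Loopless = ∀ e → proj₁ (ends e) ≢ proj₂ (ends e)

  Bipartite⇒Loopless : Bipartite → Loopless
  Bipartite⇒Loopless (colour , proper) e same = proper e (cong colour same)

  tail-α : Loopless → ∀ x → tail x ≢ tail (α x)
  tail-α loopless (e , false) = loopless e
  tail-α loopless (e , true)  = loopless e ∘ sym

  tail-injective-on-edge : Loopless → ∀ {e b b'} → tail (e , b) ≡ tail (e , b') → b ≡ b'
  tail-injective-on-edge loopless {b = false} {false} _    = refl
  tail-injective-on-edge loopless {b = false} {true}  same = ⊥-elim (loopless _ same)
  tail-injective-on-edge loopless {b = true}  {false} same = ⊥-elim (loopless _ (sym same))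
  tail-injective-on-edge loopless {b = true}  {true}  _    = refl

  tail-Inc : ∀ x → Inc ends (tail x) (proj₁ x)
  tail-Inc (e , false) = inj₁ refl
  tail-Inc (e , true)  = inj₂ refl

  tail-cases : ∀ x b → tail (proj₁ x , b) ≡ tail x ⊎ tail (proj₁ x , b) ≡ tail (α x)
  tail-cases (e , false) false = inj₁ refl
  tail-cases (e , false) true  = inj₂ refl
  tail-cases (e , true)  false = inj₂ refl
  tail-cases (e , true)  true  = inj₁ refl

  tail-iterσ : ∀ i d → tail (iter σ i d) ≡ tail d
  tail-iterσ zero    d = refl
  tail-iterσ (suc i) d = trans (σ-vertex _) (tail-iterσ i d)

  incident : Fin m → Fin n → Bool
  incident e v = ⌊ proj₁ (ends e) ≟ v ⌋ ∨ ⌊ proj₂ (ends e) ≟ v ⌋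

  Inc⇔incident : ∀ {v e} → Inc ends v e ⇔ T (incident e v)
  Inc⇔incident {v} {e} = mk⇔
    (Equivalence.from (T-∨ {⌊ proj₁ (ends e) ≟ v ⌋}) ∘ Sum.map fromWitness fromWitness)
    (Sum.map toWitness toWitness ∘ Equivalence.to (T-∨ {⌊ proj₁ (ends e) ≟ v ⌋}))

  deg-perfect : (M : PerfectMatching) → ∀ v → deg (proj₁ M) v ≡ 1
  deg-perfect (M , perfect) v = ≡ᵇ⇒≡ _ _ (All.lookup (all⁺ _ (allFin n) perfect) (∈-allFin v))

  matchingEdge : (M : PerfectMatching) → ∀ v → ∃[ e ] (lookup (proj₁ M) e ≡ true × Inc ends v e)
  matchingEdge M v with countFin≡1⇒witness _ (deg-perfect M v)
  ... | e , in-M∧inc with Equivalence.to (T-∧ {lookup (proj₁ M) e} {incident e v}) in-M∧inc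
  ... | in-M , inc = e , Equivalence.to T-≡ in-M , Equivalence.from Inc⇔incident inc

  matchingEdge-unique : (M : PerfectMatching) → ∀ {v e e'} →
    lookup (proj₁ M) e ≡ true → Inc ends v e → lookup (proj₁ M) e' ≡ true → Inc ends v e' → e ≡ e'
  matchingEdge-unique M {v} Me ve Me' ve' =
    countFin≡1⇒unique _ (deg-perfect M v) (selected Me ve) (selected Me' ve')
    where
    selected : ∀ {e} → lookup (proj₁ M) e ≡ true → Inc ends v e → T (lookup (proj₁ M) e ∧ incident e v)
    selected Me ve = Equivalence.from T-∧ (Equivalence.from T-≡ Me , Equivalence.to Inc⇔incident ve)

  matchingDart : (M : PerfectMatching) → ∀ v → ∃[ x ] (tail x ≡ v × lookup (proj₁ M) (proj₁ x) ≡ true)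
  matchingDart M v with matchingEdge M v
  ... | e , Me , inj₁ end = (e , false) , end , Me
  ... | e , Me , inj₂ end = (e , true)  , end , Me

  matchingDart-unique : Loopless → (M : PerfectMatching) → ∀ {x y} → tail x ≡ tail y →
    lookup (proj₁ M) (proj₁ x) ≡ true → lookup (proj₁ M) (proj₁ y) ≡ true → x ≡ y
  matchingDart-unique loopless M {x} {y} same Mx My
    with matchingEdge-unique M Mx (subst (λ v → Inc ends v (proj₁ x)) same (tail-Inc x)) My (tail-Inc y)
  ... | refl = cong (proj₁ x ,_) (tail-injective-on-edge loopless same)

  Merge-reflexive : ∀ {f g} → f ≡ g → Merge f g
  Merge-reflexive refl = mrefl

  Merge-trans : ∀ {f g h} → Merge f g → Merge g h → Merge f h
  Merge-trans p mrefl                   = p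
  Merge-trans p (mstep e b q forbidden) = mstep e b (Merge-trans p q) forbidden

  Merge-across : ∀ e b → Forbidden e → Merge (side e b) (side e (not b))
  Merge-across e b forbidden = mstep e b mrefl forbidden

  Merge-sym : ∀ {f g} → Merge f g → Merge g f
  Merge-sym mrefl                   = mrefl
  Merge-sym (mstep e b q forbidden) = Merge-trans (back b) (Merge-sym q)
    where
    back : ∀ b → Merge (side e (not b)) (side e b)
    back false = Merge-across e true forbidden
    back true  = Merge-across e false forbidden

  face-φ : ∀ d → face d ≡ face (φ d)
  face-φ d = face-orb d (φ d) (1 , refl)

  face-α≡face-σ : ∀ d → face (α d) ≡ face (σ d)
  face-α≡face-σ d = face-orb (α d) (σ d) (1 , cong σ (α-involutive d))

  Merge-σ : ∀ d → Forbidden (proj₁ d) → Merge (face d) (face (σ d))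
  Merge-σ d forbidden =
    Merge-trans (Merge-across (proj₁ d) (proj₂ d) forbidden) (Merge-reflexive (face-α≡face-σ d))

module UniquePerfectMatching (G : PlaneGraph) (loopless : PlaneGraphProperties.Loopless G)
         (M₀ : PG.PerfectMatching G) (unique : ∀ M → M ≡ M₀) where
  open PG G
  open PlaneGraphProperties G

  Allowed⇒∈M₀ : ∀ {e} → Allowed e → lookup (proj₁ M₀) e ≡ true
  Allowed⇒∈M₀ {e} (M , Me) = subst (λ M → lookup (proj₁ M) e ≡ true) (unique M) Me

  ∉M₀⇒Forbidden : ∀ {e} → lookup (proj₁ M₀) e ≡ false → Forbidden e
  ∉M₀⇒Forbidden ∉M₀ allowed with trans (sym (Allowed⇒∈M₀ allowed)) ∉M₀
  ... | ()

  module AroundVertex (v : Fin n) where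
    matched : Dart m
    matched = proj₁ (matchingDart M₀ v)

    matched-at-v : tail matched ≡ v
    matched-at-v = proj₁ (proj₂ (matchingDart M₀ v))

    matched∈M₀ : lookup (proj₁ M₀) (proj₁ matched) ≡ true
    matched∈M₀ = proj₂ (proj₂ (matchingDart M₀ v))

    -- Only the matched dart at v has an allowed edge, so turning σ from σ matched
    -- crosses forbidden edges only, until matched is reached and σ matched again.
    faces-around : ∀ i → Merge (face (iter σ i (σ matched))) (face (σ matched))
    faces-around zero = mrefl
    faces-around (suc i) with lookup (proj₁ M₀) (proj₁ (iter σ i (σ matched))) in ∈M₀?
    ... | true  = Merge-reflexive (cong (face ∘ σ)
          (matchingDart-unique loopless M₀ (trans (tail-iterσ i (σ matched)) (σ-vertex matched))
             ∈M₀? matched∈M₀))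
    ... | false = Merge-trans (Merge-sym (Merge-σ _ (∉M₀⇒Forbidden ∈M₀?))) (faces-around i)

    Merge-at : ∀ d → tail d ≡ v → Merge (face d) (face (σ matched))
    Merge-at d at-v with σ-cyclic (σ matched) d (trans (σ-vertex matched) (trans matched-at-v (sym at-v)))
    ... | i , refl = faces-around i

  Merge-at-vertex : ∀ {d d'} → tail d ≡ tail d' → Merge (face d) (face d')
  Merge-at-vertex {d} {d'} same = Merge-trans (Merge-at d refl) (Merge-sym (Merge-at d' (sym same)))
    where open AroundVertex (tail d)

  Merge-along-edge : ∀ e b → Merge (face (e , b)) (face (e , not b))
  Merge-along-edge e b =
    Merge-trans (Merge-reflexive (face-φ (e , b))) (Merge-at-vertex (σ-vertex (e , not b)))

  Merge-in-component : ∀ {d d'} → Conn (tail d) (tail d') → Merge (face d) (face d')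
  Merge-in-component {d} {d'} conn =
    Reach-transport MergedAt cross conn (λ _ → Merge-at-vertex ∘ sym) d' refl
    where
    MergedAt : Fin n → Set
    MergedAt u = ∀ d'' → tail d'' ≡ u → Merge (face d) (face d'')
    cross : ∀ e → ⊤ → ∀ b → MergedAt (tail (e , b)) → MergedAt (tail (e , not b))
    cross e _ b merged d'' at =
      Merge-trans (Merge-trans (merged (e , b) refl) (Merge-along-edge e b)) (Merge-at-vertex (sym at))

  -- The outer walk of a component bounds either the infinite face or a finite face,
  -- whose outer boundary lies in a component of strictly smaller depth.
  Merge-infinite : ∀ d → Merge (face d) zero
  Merge-infinite d = outwards d (<-wellFounded (depth (tail d)))
    where
    outwards : ∀ d → Acc _<_ (depth (tail d)) → Merge (face d) zero
    outwards d (acc shallower) with outer-ex d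
    ... | d' , outer-d' , conn = Merge-trans (Merge-in-component conn) (leave (face d') refl)
      where
      leave : ∀ f → face d' ≡ f → Merge (face d') zero
      leave zero    face-d' = Merge-reflexive face-d'
      leave (suc f) face-d' with inner-ex f
      ... | d'' , inner-d'' , face-d'' =
        Merge-trans (Merge-reflexive same-face) (outwards d'' (shallower (subst (depth (tail d'') <_)
          (sym (depth-conn _ _ conn)) (depth-nest d' d'' outer-d' inner-d'' same-face))))
        where
        same-face : face d' ≡ face d''
        same-face = trans face-d' (sym face-d'')

  weaklyElementary : WeaklyElementary
  weaklyElementary (f , ¬f∼∞ , e , b , _ , f∼eb) = ¬f∼∞ (Merge-trans f∼eb (Merge-infinite (e , b)))

  eachElemCompK2 : EachElemCompK2
  eachElemCompK2 v =
    w , v≢w , component , e , (M₀ , matched∈M₀) , v-end , tail-Inc (α matched) , allowed-unique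
    where
    open AroundVertex v

    e : Fin m
    e = proj₁ matched

    w : Fin n
    w = tail (α matched)

    v≢w : v ≢ w
    v≢w = tail-α loopless matched ∘ trans matched-at-v

    v-end : Inc ends v e
    v-end = subst (λ u → Inc ends u e) matched-at-v (tail-Inc matched)

    allowed-unique : ∀ e' → Allowed e' → Inc ends v e' ⊎ Inc ends w e' → e' ≡ e
    allowed-unique e' allowed (inj₁ at-v) =
      matchingEdge-unique M₀ (Allowed⇒∈M₀ allowed) at-v matched∈M₀ v-end
    allowed-unique e' allowed (inj₂ at-w) =
      matchingEdge-unique M₀ (Allowed⇒∈M₀ allowed) at-w matched∈M₀ (tail-Inc (α matched))

    OnE : Fin n → Set
    OnE u = u ≡ v ⊎ u ≡ w

    closed : ∀ e' → Allowed e' → ∀ b → OnE (tail (e' , b)) → OnE (tail (e' , not b))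
    closed e' allowed b on-e with allowed-unique e' allowed
      (Sum.map (λ eq → subst (λ u → Inc ends u e') eq (tail-Inc (e' , b)))
               (λ eq → subst (λ u → Inc ends u e') eq (tail-Inc (e' , b))) on-e)
    ... | refl = Sum.map (λ eq → trans eq matched-at-v) id (tail-cases matched (not b))

    component : ∀ u → ElemReach v u → OnE u
    component u reach = Reach-transport OnE closed reach (inj₁ refl)

module _ (G : PlaneGraph) where
  open PG G

  open PlaneGraphProperties G using (matchingEdge)

  R-irreflexive : ∀ M → ¬ Adj R M M
  R-irreflexive (M , _) (f , _ , M⊕M≡∂f , (e , e∈∂f) , _) with
    trans (sym e∈∂f) (trans (cong (λ S → lookup S e) (sym M⊕M≡∂f))
                            (trans (lookup-zipWith _xor_ e M M) (xor-same (lookup M e))))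
  ... | ()

  EachElemCompK2⇒Allowed∈ : EachElemCompK2 → (M : PerfectMatching) → ∀ {e} → Allowed e →
    lookup (proj₁ M) e ≡ true
  EachElemCompK2⇒Allowed∈ k2 M {e} allowed
    with k2 (proj₁ (ends e)) | matchingEdge M (proj₁ (ends e))
  ... | _ , _ , _ , _ , _ , _ , _ , unique | e' , Me' , e'-at
    with unique e allowed (inj₁ (inj₁ refl)) | unique e' (M , Me') (inj₁ e'-at)
  ... | refl | refl = Me'

  EachElemCompK2⇒uniquePM : EachElemCompK2 → (M M' : PerfectMatching) → M ≡ M'
  EachElemCompK2⇒uniquePM k2 (M , perfect) (M' , perfect') =
    Σ-≡,≡→≡ (same-edges , T-irrelevant _ perfect')
    where
    same-edges : M ≡ M'
    same-edges = trans (sym (tabulate∘lookup M)) (trans (tabulate-cong λ i → ⇔→≡ (mk⇔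
      (λ Mi → EachElemCompK2⇒Allowed∈ k2 (M' , perfect') ((M , perfect) , Mi))
      (λ M'i → EachElemCompK2⇒Allowed∈ k2 (M , perfect) ((M' , perfect') , M'i))))
      (tabulate∘lookup M'))

lemma2p2 : (G : PlaneGraph) → PG.Bipartite G → PG.PerfectMatching G →
    (IsDaisyCube (PG.R G) × Idim (PG.R G) 0)
      ⇔ (PG.WeaklyElementary G × PG.EachElemCompK2 G)
lemma2p2 G bipartite M₀ = mk⇔
  (λ { (_ , idim) →
    let open UniquePerfectMatching G (PlaneGraphProperties.Bipartite⇒Loopless G bipartite) M₀
               (λ M → isometric-Q₀⇒trivial (proj₁ idim) M M₀)
    in weaklyElementary , eachElemCompK2 })
  (λ { (_ , k2) →
    let trivial = EachElemCompK2⇒uniquePM G k2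
    in inj₂ (trivial⇒≅K1 trivial M₀ (R-irreflexive G)) , trivial⇒Idim0 trivial })
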